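{- If $M:\langle\Gamma\vdash U\rangle$ and $M\rhd_\beta N$ (one step), then $N:\langle\Gamma\restriction_N\vdash U\rangle$.
   Context: Terms: $\mathcal V$ is a denumerably infinite set of variables; $\mathcal M$ is the set of untyped $\lambda$-terms $M::=x\mid \lambda x.M\mid MM$ taken modulo $\alpha$-conversion; $FV(M)$ is the set of free variables; $M[x:=N]$ is capture-avoiding substitution. $\rhd_\beta$ is the compatible closure of $(\lambda x.M)N\rhd_\beta M[x:=N]$. Types: $\mathcal A$ is a denumerably infinite set of atomic types; $\mathbb T::=a\mid \mathbb U\to\mathbb T$ ($a\in\mathcal A$) and $\mathbb U::=\omega\mid \mathbb U\sqcap\mathbb U\mid \mathbb T$; types are quotiented by commutativity, associativity and idempotence of $\sqcap$ and by $\omega\sqcap U=U$. $T$ ranges over $\mathbb T$, $U,V$ over $\mathbb U$. Environments: a type environment is a finite set $(x_i:U_i)_n$ of declarations with pairwise distinct variables; $dom$ is its set of variables; $\Gamma,x:U$ requires $x\notin dom(\Gamma)$; $env^M_\omega$ assigns $\omega$ to each variable of $FV(M)$ and nothing else; if $\Gamma_1=(x_i:U_i)_n,(y_j:V_j)_m$ and $\Gamma_2=(x_i:U'_i)_n,(z_k:W_k)_l$ with the $y_j$, $z_k$ all distinct, then $\Gamma_1\sqcap\Gamma_2=(x_i:U_i\sqcap U'_i)_n,(y_j:V_j)_m,(z_k:W_k)_l$. For $\mathcal U\subseteq dom(\Gamma)$, $\Gamma\restriction_{\mathcal U}$ is the restriction of $\Gamma$ to the variables in $\mathcal U$, and $\Gamma\restriction_N$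 means $\Gamma\restriction_{FV(N)}$. Subtyping: $\sqsubseteq$ (on types, on environments, and on typings $\langle\Gamma\vdash U\rangle$) is the least relation closed under: $\Phi\sqsubseteq\Phi$; transitivity; $U_1\sqcap U_2\sqsubseteq U_1$; if $U_1\sqsubseteq V_1$ and $U_2\sqsubseteq V_2$ then $U_1\sqcap U_2\sqsubseteq V_1\sqcap V_2$; if $U_2\sqsubseteq U_1$ and $T_1\sqsubseteq T_2$ then $U_1\to T_1\sqsubseteq U_2\to T_2$; if $U_1\sqsubseteq U_2$ and $x\notin dom(\Gamma)$ then $\Gamma,x:U_1\sqsubseteq\Gamma,x:U_2$; if $U_1\sqsubseteq U_2$ and $\Gamma_2\sqsubseteq\Gamma_1$ then $\langle\Gamma_1\vdash U_1\rangle\sqsubseteq\langle\Gamma_2\vdash U_2\rangle$. Typing rules for $M:\langle\Gamma\vdash U\rangle$: (ax) $x:\langle x:T\vdash T\rangle$ for $T\in\mathbb T$; ($\omega$) $M:\langle env^M_\omega\vdash\omega\rangle$; ($\to_i$) from $M:\langle\Gamma,x:U\vdash T\rangle$ infer $\lambda x.M:\langle\Gamma\vdash U\to T\rangle$; ($\to'_i$) from $M:\langle\Gamma\vdash T\rangle$ and $x\notin dom(\Gamma)$ infer $\lambda x.M:\langle\Gamma\vdash\omega\to T\rangle$; ($\to_e$) from $M_1:\langle\Gamma_1\vdash U\to T\rangle$ and $M_2:\langle\Gamma_2\vdash U\rangle$ infer $M_1M_2:\langle\Gamma_1\sqcap\Gamma_2\vdash T\rangle$; ($\sqcap_i$) from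 $M:\langle\Gamma\vdash U_1\rangle$ and $M:\langle\Gamma\vdash U_2\rangle$ infer $M:\langle\Gamma\vdash U_1\sqcap U_2\rangle$; ($\sqsubseteq$) from $M:\langle\Gamma\vdash U\rangle$ and $\langle\Gamma\vdash U\rangle\sqsubseteq\langle\Gamma'\vdash U'\rangle$ infer $M:\langle\Gamma'\vdash U'\rangle$. -}

module Defs where

open import Data.Nat using (ℕ; zero; suc; _≡ᵇ_)
open import Data.Bool using (Bool; true; false; if_then_else_; _∨_)
open import Data.Maybe using (Maybe; just; nothing)

-- Terms: untyped λ-terms modulo α-conversion, represented with
-- de Bruijn indices (variables 𝒱 = ℕ; free variable n of a term under
-- k binders is written var (n + k)).

data Term : Set where
  var : ℕ → Term
  lam : Term → Term
  app : Term → Term → Term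

occurs : ℕ → Term → Bool
occurs x (var y)   = x ≡ᵇ y
occurs x (lam M)   = occurs (suc x) M
occurs x (app M N) = occurs x M ∨ occurs x N

Ren : Set
Ren = ℕ → ℕ

Sub : Set
Sub = ℕ → Term

extR : Ren → Ren
extR ρ zero    = zero
extR ρ (suc n) = suc (ρ n)

rename : Ren → Term → Term
rename ρ (var x)   = var (ρ x)
rename ρ (lam M)   = lam (rename (extR ρ) M)
rename ρ (app M N) = app (rename ρ M) (rename ρ N)

extS : Sub → Sub
extS σ zero    = var zero
extS σ (suc n) = rename suc (σ n)

subst : Sub → Term → Term
subst σ (var x)   = σ x
subst σ (lam M)   = lam (subst (extS σ) M)
subst σ (app M N) = app (subst σ M) (subst σ N)

sub0 : Term → Sub
sub0 N zero    = N
sub0 N (suc n) = var n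

_[0:=_] : Term → Term → Term
M [0:= N ] = subst (sub0 N) M

infix 4 _▷β_
data _▷β_ : Term → Term → Set where
  β     : ∀ {M N} → app (lam M) N ▷β (M [0:= N ])
  appL  : ∀ {M M' N} → M ▷β M' → app M N ▷β app M' N
  appR  : ∀ {M N N'} → N ▷β N' → app M N ▷β app M N'
  lamC  : ∀ {M M'} → M ▷β M' → lam M ▷β lam M'

-- Types (raw syntax; atomic types 𝒜 = ℕ).  The quotient by ACI of ⊓
-- and ω ⊓ U = U is incorporated into the subtyping relation below
-- (U, V are identified iff U ⊑ V and V ⊑ U).

infixr 7 _⇒_
infixl 8 _⊓_

mutual
  data Ty : Set where
    atom : ℕ → Ty
    _⇒_  : UTy → Ty → Ty

  data UTy : Set where
    ω   : UTy
    _⊓_ : UTy → UTy → UTy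
    ⟪_⟫ : Ty → UTy

infix 4 _⊑_
data _⊑_ : UTy → UTy → Set where
  ⊑-refl  : ∀ {U} → U ⊑ U
  ⊑-trans : ∀ {U V W} → U ⊑ V → V ⊑ W → U ⊑ W
  ⊑-⊓l    : ∀ {U₁ U₂} → U₁ ⊓ U₂ ⊑ U₁
  ⊑-⊓     : ∀ {U₁ U₂ V₁ V₂} → U₁ ⊑ V₁ → U₂ ⊑ V₂ → U₁ ⊓ U₂ ⊑ V₁ ⊓ V₂
  ⊑-⇒     : ∀ {U₁ U₂ T₁ T₂} → U₂ ⊑ U₁ → ⟪ T₁ ⟫ ⊑ ⟪ T₂ ⟫ →
            ⟪ U₁ ⇒ T₁ ⟫ ⊑ ⟪ U₂ ⇒ T₂ ⟫
  -- generating equations of the quotient (both directions)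
  ⊑-comm  : ∀ {U₁ U₂} → U₁ ⊓ U₂ ⊑ U₂ ⊓ U₁
  ⊑-assoc₁ : ∀ {U₁ U₂ U₃} → (U₁ ⊓ U₂) ⊓ U₃ ⊑ U₁ ⊓ (U₂ ⊓ U₃)
  ⊑-assoc₂ : ∀ {U₁ U₂ U₃} → U₁ ⊓ (U₂ ⊓ U₃) ⊑ (U₁ ⊓ U₂) ⊓ U₃
  ⊑-idem  : ∀ {U} → U ⊑ U ⊓ U
  ⊑-unit₁ : ∀ {U} → ω ⊓ U ⊑ U
  ⊑-unit₂ : ∀ {U} → U ⊑ ω ⊓ U

-- Environments: partial maps from variables to 𝕌 (nothing = not in dom).
-- Every derivable typing has an environment of finite domain (= FV(M)).

Env : Set
Env = ℕ → Maybe UTy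

_↦_ : ℕ → UTy → Env
(x ↦ U) y = if x ≡ᵇ y then just U else nothing

_▸_ : Maybe UTy → Env → Env
(m ▸ Γ) zero    = m
(m ▸ Γ) (suc n) = Γ n

envω : Term → Env
envω M x = if occurs x M then just ω else nothing

_⊓E_ : Env → Env → Env
(Γ₁ ⊓E Γ₂) x with Γ₁ x | Γ₂ x
... | just U  | just V  = just (U ⊓ V)
... | just U  | nothing = just U
... | nothing | just V  = just V
... | nothing | nothing = nothing

_↾_ : Env → Term → Env
(Γ ↾ N) x = if occurs x N then Γ x else nothing

data _⊑M_ : Maybe UTy → Maybe UTy → Set where
  nothing⊑ : nothing ⊑M nothing
  just⊑    : ∀ {U V} → U ⊑ V → just U ⊑M just V

_⊑E_ : Env → Env → Set
Γ ⊑E Γ' = ∀ x → Γ x ⊑M Γ' x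

infix 3 _⦂⟨_⊢_⟩
data _⦂⟨_⊢_⟩ : Term → Env → UTy → Set where
  ax   : ∀ {x T} → var x ⦂⟨ x ↦ ⟪ T ⟫ ⊢ ⟪ T ⟫ ⟩
  ωi   : ∀ {M} → M ⦂⟨ envω M ⊢ ω ⟩
  ⇒i   : ∀ {M Γ U T} → M ⦂⟨ just U ▸ Γ ⊢ ⟪ T ⟫ ⟩ → lam M ⦂⟨ Γ ⊢ ⟪ U ⇒ T ⟫ ⟩
  ⇒i'  : ∀ {M Γ T} → M ⦂⟨ nothing ▸ Γ ⊢ ⟪ T ⟫ ⟩ → lam M ⦂⟨ Γ ⊢ ⟪ ω ⇒ T ⟫ ⟩
  ⇒e   : ∀ {M₁ M₂ Γ₁ Γ₂ U T} → M₁ ⦂⟨ Γ₁ ⊢ ⟪ U ⇒ T ⟫ ⟩ → M₂ ⦂⟨ Γ₂ ⊢ U ⟩ →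
         app M₁ M₂ ⦂⟨ Γ₁ ⊓E Γ₂ ⊢ ⟪ T ⟫ ⟩
  ⊓i   : ∀ {M Γ U₁ U₂} → M ⦂⟨ Γ ⊢ U₁ ⟩ → M ⦂⟨ Γ ⊢ U₂ ⟩ → M ⦂⟨ Γ ⊢ U₁ ⊓ U₂ ⟩
  sub  : ∀ {M Γ Γ' U U'} → M ⦂⟨ Γ ⊢ U ⟩ → U ⊑ U' → Γ' ⊑E Γ → M ⦂⟨ Γ' ⊢ U' ⟩

module Submission where

-- Three general facts carry it.
--  * Inversion of subtyping: through a structural characterisation of ⊑
--    (a type is below an arrow iff one of its conjuncts is, and arrows compare
--    contravariantly/covariantly), typings of an abstraction can be inverted.
--  * Domain invariant: a derivable M : ⟨Γ ⊢ U⟩ has dom(Γ) = FV(M).  Hence an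
--    environment may be replaced by any environment that refines it on FV(M),
--    provided we then restrict to FV(M) (restrict-weaken); in particular
--    typings of the shape P : ⟨Δ ↾ P ⊢ U⟩ are closed under the typing rules.
--  * Renaming and substitution lemmas for such restricted typings.
-- The β case combines inversion for λ with the substitution lemma, the
-- (ω) case uses FV(N) ⊆ FV(M) for M ▷β N, and the congruence cases use
-- restrict-weaken to pass from Γᵢ ↾ N to (Γ₁ ⊓ Γ₂) ↾ N.

open import Defs
open import Data.Nat using (ℕ; zero; suc; _≡ᵇ_)
open import Data.Nat.Properties using (≡ᵇ⇒≡; ≡⇒≡ᵇ)
open import Data.Bool using (true; false; _∨_)
open import Data.Bool.Properties using (T-≡; ∨-zeroʳ)
open import Data.Maybe using (Maybe; just; nothing; is-just)
open import Data.Product using (∃-syntax; _×_; _,_)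
open import Data.Sum using (_⊎_; inj₁; inj₂; [_,_])
open import Data.Empty using (⊥; ⊥-elim)
open import Data.Unit using (⊤; tt)
open import Function using (_∘_; Equivalence)
open import Relation.Nullary using (¬_)
open import Relation.Binary.PropositionalEquality
  using (_≡_; refl; sym; trans; cong; cong₂) renaming (subst to subst≡)

≡ᵇ-true⇒≡ : ∀ m n → (m ≡ᵇ n) ≡ true → m ≡ n
≡ᵇ-true⇒≡ m n e = ≡ᵇ⇒≡ m n (Equivalence.from T-≡ e)

≡ᵇ-refl : ∀ n → (n ≡ᵇ n) ≡ true
≡ᵇ-refl n = Equivalence.to T-≡ (≡⇒≡ᵇ n n refl)

≡ᵇ-sym : ∀ m n → (m ≡ᵇ n) ≡ (n ≡ᵇ m)
≡ᵇ-sym zero    zero    = refl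
≡ᵇ-sym zero    (suc n) = refl
≡ᵇ-sym (suc m) zero    = refl
≡ᵇ-sym (suc m) (suc n) = ≡ᵇ-sym m n

_∈FV_ : ℕ → Term → Set
x ∈FV M = occurs x M ≡ true

∈FV-app : ∀ x M N → x ∈FV app M N → x ∈FV M ⊎ x ∈FV N
∈FV-app x M N e with occurs x M
... | true  = inj₁ refl
... | false = inj₂ e

∈FV-appˡ : ∀ {x} M N → x ∈FV M → x ∈FV app M N
∈FV-appˡ M N e rewrite e = refl

∈FV-appʳ : ∀ {x} M N → x ∈FV N → x ∈FV app M N
∈FV-appʳ {x} M N e rewrite e = ∨-zeroʳ (occurs x M)

FV-rename : ∀ ρ M y → y ∈FV rename ρ M → ∃[ x ] (x ∈FV M × y ≡ ρ x)
FV-rename ρ (var x) y e = x , ≡ᵇ-refl x , ≡ᵇ-true⇒≡ y (ρ x) e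
FV-rename ρ (lam M) y e with FV-rename (extR ρ) M (suc y) e
... | zero  , _   , ()
... | suc x , x∈M , refl = x , x∈M , refl
FV-rename ρ (app M N) y e with ∈FV-app y (rename ρ M) (rename ρ N) e
... | inj₁ e₁ = let x , x∈M , eq = FV-rename ρ M y e₁ in x , ∈FV-appˡ M N x∈M , eq
... | inj₂ e₂ = let x , x∈N , eq = FV-rename ρ N y e₂ in x , ∈FV-appʳ M N x∈N , eq

FV-subst : ∀ σ M y → y ∈FV subst σ M → ∃[ x ] (x ∈FV M × y ∈FV σ x)
FV-subst σ (var x) y e = x , ≡ᵇ-refl x , e
FV-subst σ (lam M) y e with FV-subst (extS σ) M (suc y) e
... | zero  , _   , ()
... | suc x , x∈M , y∈σx with FV-rename suc (σ x) (suc y) y∈σx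
...   | z , z∈σx , refl = x , x∈M , z∈σx
FV-subst σ (app M N) y e with ∈FV-app y (subst σ M) (subst σ N) e
... | inj₁ e₁ = let x , x∈M , y∈ = FV-subst σ M y e₁ in x , ∈FV-appˡ M N x∈M , y∈
... | inj₂ e₂ = let x , x∈N , y∈ = FV-subst σ N y e₂ in x , ∈FV-appʳ M N x∈N , y∈

FV-reduct : ∀ {M N} → M ▷β N → ∀ y → y ∈FV N → y ∈FV M
FV-reduct (β {M} {N}) y e with FV-subst (sub0 N) M y e
... | zero  , _   , y∈N = ∈FV-appʳ (lam M) N y∈N
... | suc x , x∈M , y≡x with ≡ᵇ-true⇒≡ y x y≡x
...   | refl = ∈FV-appˡ (lam M) N x∈M
FV-reduct (appL {M} {M'} {N} s) y e with ∈FV-app y M' N e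
... | inj₁ e₁ = ∈FV-appˡ M N (FV-reduct s y e₁)
... | inj₂ e₂ = ∈FV-appʳ M N e₂
FV-reduct (appR {M} {N} {N'} s) y e with ∈FV-app y M N' e
... | inj₁ e₁ = ∈FV-appˡ M N e₁
... | inj₂ e₂ = ∈FV-appʳ M N (FV-reduct s y e₂)
FV-reduct (lamC s) y e = FV-reduct s (suc y) e

-- Structural subtyping.  U ≤U V compares U with every conjunct of V;
-- U ∋≤ T says that some conjunct of U lies below the arrow/atom T.

infix 4 _≤T_ _≤U_ _∋≤_

mutual
  _≤T_ : Ty → Ty → Set
  atom a    ≤T atom b    = a ≡ b
  (U₁ ⇒ T₁) ≤T (U₂ ⇒ T₂) = U₂ ≤U U₁ × T₁ ≤T T₂
  _         ≤T _         = ⊥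

  _≤U_ : UTy → UTy → Set
  U ≤U ω         = ⊤
  U ≤U (V₁ ⊓ V₂) = U ≤U V₁ × U ≤U V₂
  U ≤U ⟪ T ⟫     = U ∋≤ T

  _∋≤_ : UTy → Ty → Set
  ω         ∋≤ T = ⊥
  (U₁ ⊓ U₂) ∋≤ T = U₁ ∋≤ T ⊎ U₂ ∋≤ T
  ⟪ S ⟫     ∋≤ T = S ≤T T

≤U-⊓ˡ : ∀ {U₁ U₂} V → U₁ ≤U V → U₁ ⊓ U₂ ≤U V
≤U-⊓ˡ ω         _       = tt
≤U-⊓ˡ (V₁ ⊓ V₂) (p , q) = ≤U-⊓ˡ V₁ p , ≤U-⊓ˡ V₂ q
≤U-⊓ˡ ⟪ T ⟫     p       = inj₁ p

≤U-⊓ʳ : ∀ {U₁ U₂} V → U₂ ≤U V → U₁ ⊓ U₂ ≤U V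
≤U-⊓ʳ ω         _       = tt
≤U-⊓ʳ (V₁ ⊓ V₂) (p , q) = ≤U-⊓ʳ V₁ p , ≤U-⊓ʳ V₂ q
≤U-⊓ʳ ⟪ T ⟫     p       = inj₂ p

mutual
  ≤T-refl : ∀ T → T ≤T T
  ≤T-refl (atom a) = refl
  ≤T-refl (U ⇒ T)  = ≤U-refl U , ≤T-refl T

  ≤U-refl : ∀ U → U ≤U U
  ≤U-refl ω         = tt
  ≤U-refl (U₁ ⊓ U₂) = ≤U-⊓ˡ U₁ (≤U-refl U₁) , ≤U-⊓ʳ U₂ (≤U-refl U₂)
  ≤U-refl ⟪ T ⟫     = ≤T-refl T

mutual
  ≤T-trans : ∀ S T R → S ≤T T → T ≤T R → S ≤T R
  ≤T-trans (atom _) (atom _) (atom _) p q = trans p q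
  ≤T-trans (U₁ ⇒ T₁) (U₂ ⇒ T₂) (U₃ ⇒ T₃) (a , b) (c , d) =
    ≤U-trans U₃ U₂ U₁ c a , ≤T-trans T₁ T₂ T₃ b d
  ≤T-trans (atom _) (atom _) (_ ⇒ _)  _  ()
  ≤T-trans (atom _) (_ ⇒ _)  _        () _
  ≤T-trans (_ ⇒ _)  (atom _) _        () _
  ≤T-trans (_ ⇒ _)  (_ ⇒ _)  (atom _) _  ()

  ≤U-trans : ∀ U V W → U ≤U V → V ≤U W → U ≤U W
  ≤U-trans U V ω         p _         = tt
  ≤U-trans U V (W₁ ⊓ W₂) p (q₁ , q₂) = ≤U-trans U V W₁ p q₁ , ≤U-trans U V W₂ p q₂
  ≤U-trans U V ⟪ R ⟫     p q         = ∋≤-≤U U V R p q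

  ∋≤-≤U : ∀ U V R → U ≤U V → V ∋≤ R → U ∋≤ R
  ∋≤-≤U U ω         R p         ()
  ∋≤-≤U U (V₁ ⊓ V₂) R (p₁ , _)  (inj₁ q) = ∋≤-≤U U V₁ R p₁ q
  ∋≤-≤U U (V₁ ⊓ V₂) R (_  , p₂) (inj₂ q) = ∋≤-≤U U V₂ R p₂ q
  ∋≤-≤U U ⟪ T ⟫     R p         q        = ∋≤-≤T U T R p q

  ∋≤-≤T : ∀ U T R → U ∋≤ T → T ≤T R → U ∋≤ R
  ∋≤-≤T ω         T R ()       _
  ∋≤-≤T (U₁ ⊓ U₂) T R (inj₁ p) q = inj₁ (∋≤-≤T U₁ T R p q)
  ∋≤-≤T (U₁ ⊓ U₂) T R (inj₂ p) q = inj₂ (∋≤-≤T U₂ T R p q)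
  ∋≤-≤T ⟪ S ⟫     T R p        q = ≤T-trans S T R p q

⊑⇒≤U : ∀ {U V} → U ⊑ V → U ≤U V
⊑⇒≤U {U} ⊑-refl = ≤U-refl U
⊑⇒≤U {U} {W} (⊑-trans {V = V} p q) = ≤U-trans U V W (⊑⇒≤U p) (⊑⇒≤U q)
⊑⇒≤U {U₁ ⊓ _} ⊑-⊓l = ≤U-⊓ˡ U₁ (≤U-refl U₁)
⊑⇒≤U (⊑-⊓ {V₁ = V₁} {V₂ = V₂} p q) = ≤U-⊓ˡ V₁ (⊑⇒≤U p) , ≤U-⊓ʳ V₂ (⊑⇒≤U q)
⊑⇒≤U (⊑-⇒ p q) = ⊑⇒≤U p , ⊑⇒≤U q
⊑⇒≤U (⊑-comm {U₁} {U₂}) = ≤U-⊓ʳ U₂ (≤U-refl U₂) , ≤U-⊓ˡ U₁ (≤U-refl U₁)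
⊑⇒≤U (⊑-assoc₁ {U₁} {U₂} {U₃}) =
  ≤U-⊓ˡ U₁ (≤U-⊓ˡ U₁ (≤U-refl U₁)) , ≤U-⊓ˡ U₂ (≤U-⊓ʳ U₂ (≤U-refl U₂)) , ≤U-⊓ʳ U₃ (≤U-refl U₃)
⊑⇒≤U (⊑-assoc₂ {U₁} {U₂} {U₃}) =
  (≤U-⊓ˡ U₁ (≤U-refl U₁) , ≤U-⊓ʳ U₂ (≤U-⊓ˡ U₂ (≤U-refl U₂))) , ≤U-⊓ʳ U₃ (≤U-⊓ʳ U₃ (≤U-refl U₃))
⊑⇒≤U (⊑-idem {U}) = ≤U-refl U , ≤U-refl U
⊑⇒≤U (⊑-unit₁ {U}) = ≤U-⊓ʳ U (≤U-refl U)
⊑⇒≤U (⊑-unit₂ {U}) = tt , ≤U-refl U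

⊑-ω : ∀ {U} → U ⊑ ω
⊑-ω = ⊑-trans ⊑-unit₂ ⊑-⊓l

⊑-⊓r : ∀ {U₁ U₂} → U₁ ⊓ U₂ ⊑ U₂
⊑-⊓r = ⊑-trans ⊑-comm ⊑-⊓l

mutual
  ≤U⇒⊑ : ∀ U V → U ≤U V → U ⊑ V
  ≤U⇒⊑ U ω         _       = ⊑-ω
  ≤U⇒⊑ U (V₁ ⊓ V₂) (p , q) = ⊑-trans ⊑-idem (⊑-⊓ (≤U⇒⊑ U V₁ p) (≤U⇒⊑ U V₂ q))
  ≤U⇒⊑ U ⟪ T ⟫     p       = ∋≤⇒⊑ U T p

  ∋≤⇒⊑ : ∀ U T → U ∋≤ T → U ⊑ ⟪ T ⟫
  ∋≤⇒⊑ ω         T ()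
  ∋≤⇒⊑ (U₁ ⊓ U₂) T (inj₁ p) = ⊑-trans ⊑-⊓l (∋≤⇒⊑ U₁ T p)
  ∋≤⇒⊑ (U₁ ⊓ U₂) T (inj₂ p) = ⊑-trans ⊑-⊓r (∋≤⇒⊑ U₂ T p)
  ∋≤⇒⊑ ⟪ S ⟫     T p        = ≤T⇒⊑ S T p

  ≤T⇒⊑ : ∀ S T → S ≤T T → ⟪ S ⟫ ⊑ ⟪ T ⟫
  ≤T⇒⊑ (atom a)  (atom .a)  refl    = ⊑-refl
  ≤T⇒⊑ (U₁ ⇒ T₁) (U₂ ⇒ T₂) (p , q) = ⊑-⇒ (≤U⇒⊑ U₂ U₁ p) (≤T⇒⊑ T₁ T₂ q)

ω⋢ : ∀ {T} → ¬ (ω ⊑ ⟪ T ⟫)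
ω⋢ = ⊑⇒≤U

⊓⊑-inv : ∀ {U₁ U₂ T} → U₁ ⊓ U₂ ⊑ ⟪ T ⟫ → U₁ ⊑ ⟪ T ⟫ ⊎ U₂ ⊑ ⟪ T ⟫
⊓⊑-inv {U₁} {U₂} {T} p with ⊑⇒≤U p
... | inj₁ q = inj₁ (∋≤⇒⊑ U₁ T q)
... | inj₂ q = inj₂ (∋≤⇒⊑ U₂ T q)

⇒⊑⇒-inv : ∀ {U₁ U₂ T₁ T₂} → ⟪ U₁ ⇒ T₁ ⟫ ⊑ ⟪ U₂ ⇒ T₂ ⟫ → U₂ ⊑ U₁ × ⟪ T₁ ⟫ ⊑ ⟪ T₂ ⟫
⇒⊑⇒-inv {U₁} {U₂} {T₁} {T₂} p with ⊑⇒≤U p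
... | a , b = ≤U⇒⊑ U₂ U₁ a , ≤T⇒⊑ T₁ T₂ b

infix 4 _≤M_ _≤E_

data _≤M_ : Maybe UTy → Maybe UTy → Set where
  ≤nothing : ∀ {m} → m ≤M nothing
  ≤just    : ∀ {U V} → U ⊑ V → just U ≤M just V

_≤E_ : Env → Env → Set
Δ ≤E Γ = ∀ x → Δ x ≤M Γ x

⊑M-refl : ∀ {m} → m ⊑M m
⊑M-refl {just _}  = just⊑ ⊑-refl
⊑M-refl {nothing} = nothing⊑

≤M-refl : ∀ {m} → m ≤M m
≤M-refl {just _}  = ≤just ⊑-refl
≤M-refl {nothing} = ≤nothing

≤M-trans : ∀ {a b c} → a ≤M b → b ≤M c → a ≤M c
≤M-trans _         ≤nothing  = ≤nothing
≤M-trans (≤just p) (≤just q) = ≤just (⊑-trans p q)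

≤E-trans : ∀ {Δ Θ Γ} → Δ ≤E Θ → Θ ≤E Γ → Δ ≤E Γ
≤E-trans p q x = ≤M-trans (p x) (q x)

⊑M⇒≤M : ∀ {m m'} → m ⊑M m' → m ≤M m'
⊑M⇒≤M nothing⊑  = ≤nothing
⊑M⇒≤M (just⊑ p) = ≤just p

≤M⇒⊑M : ∀ {m m'} → m ≤M m' → is-just m' ≡ true → m ⊑M m'
≤M⇒⊑M (≤just p) _ = just⊑ p

≤M-is-just : ∀ {m m'} → m ≤M m' → is-just m' ≡ true → is-just m ≡ true
≤M-is-just (≤just _) _ = refl

⊑M-is-just : ∀ {m m'} → m ⊑M m' → is-just m ≡ is-just m'
⊑M-is-just nothing⊑  = refl
⊑M-is-just (just⊑ _) = refl

⊓E-is-just : ∀ Γ₁ Γ₂ x → is-just ((Γ₁ ⊓E Γ₂) x) ≡ is-just (Γ₁ x) ∨ is-just (Γ₂ x)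
⊓E-is-just Γ₁ Γ₂ x with Γ₁ x | Γ₂ x
... | just _  | just _  = refl
... | just _  | nothing = refl
... | nothing | just _  = refl
... | nothing | nothing = refl

⊓E-≤ˡ : ∀ Γ₁ Γ₂ → (Γ₁ ⊓E Γ₂) ≤E Γ₁
⊓E-≤ˡ Γ₁ Γ₂ x with Γ₁ x | Γ₂ x
... | just _  | just _  = ≤just ⊑-⊓l
... | just _  | nothing = ≤M-refl
... | nothing | _       = ≤nothing

⊓E-≤ʳ : ∀ Γ₁ Γ₂ → (Γ₁ ⊓E Γ₂) ≤E Γ₂
⊓E-≤ʳ Γ₁ Γ₂ x with Γ₁ x | Γ₂ x
... | just _  | just _  = ≤just ⊑-⊓r
... | nothing | just _  = ≤M-refl
... | _       | nothing = ≤nothing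

↾-≤ : ∀ Γ P → Γ ≤E (Γ ↾ P)
↾-≤ Γ P x with occurs x P
... | true  = ≤M-refl
... | false = ≤nothing

↾-⊑E : ∀ {Γ' Γ} P → Γ' ⊑E Γ → (Γ' ↾ P) ⊑E (Γ ↾ P)
↾-⊑E P q x with occurs x P
... | true  = q x
... | false = nothing⊑

↾-∈ : ∀ Γ P {y} → y ∈FV P → (Γ ↾ P) y ≡ Γ y
↾-∈ Γ P e rewrite e = refl

↦-self : ∀ x U → (x ↦ U) x ≡ just U
↦-self x U rewrite ≡ᵇ-refl x = refl

↦-is-just : ∀ x U y → is-just ((x ↦ U) y) ≡ (y ≡ᵇ x)
↦-is-just x U y with x ≡ᵇ y | ≡ᵇ-sym x y
... | true  | e = e
... | false | e = e

↦-≤E : ∀ {Δ x U} → Δ x ≤M just U → Δ ≤E (x ↦ U)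
↦-≤E {x = x} h y with x ≡ᵇ y in e
... | true rewrite ≡ᵇ-true⇒≡ x y e = h
... | false = ≤nothing

▸-⊑E : ∀ m {Γ' Γ} → Γ' ⊑E Γ → (m ▸ Γ') ⊑E (m ▸ Γ)
▸-⊑E m q zero    = ⊑M-refl
▸-⊑E m q (suc x) = q x

dom-typing : ∀ {M Γ U} → M ⦂⟨ Γ ⊢ U ⟩ → ∀ x → is-just (Γ x) ≡ occurs x M
dom-typing (ax {x} {T}) y = ↦-is-just x ⟪ T ⟫ y
dom-typing (ωi {M}) y with occurs y M
... | true  = refl
... | false = refl
dom-typing (⇒i d)  y = dom-typing d (suc y)
dom-typing (⇒i' d) y = dom-typing d (suc y)
dom-typing (⇒e {Γ₁ = Γ₁} {Γ₂ = Γ₂} d₁ d₂) y =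
  trans (⊓E-is-just Γ₁ Γ₂ y) (cong₂ _∨_ (dom-typing d₁ y) (dom-typing d₂ y))
dom-typing (⊓i d _)    y = dom-typing d y
dom-typing (sub d _ q) y = trans (⊑M-is-just (q y)) (dom-typing d y)

∈dom-↾ : ∀ {P Δ U} → P ⦂⟨ Δ ↾ P ⊢ U ⟩ → ∀ {y} → y ∈FV P → is-just (Δ y) ≡ true
∈dom-↾ {P} {Δ} d {y} e = trans (cong is-just (sym (↾-∈ Δ P e))) (trans (dom-typing d y) e)

subsume : ∀ {M Γ U V} → M ⦂⟨ Γ ⊢ U ⟩ → U ⊑ V → M ⦂⟨ Γ ⊢ V ⟩
subsume d p = sub d p (λ _ → ⊑M-refl)

-- Any Δ refining Θ types P once restricted to FV(P) = dom(Θ).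
restrict-weaken : ∀ {P Θ Δ U} → P ⦂⟨ Θ ⊢ U ⟩ → Δ ≤E Θ → P ⦂⟨ Δ ↾ P ⊢ U ⟩
restrict-weaken {P} {Θ} {Δ} d h = sub d ⊑-refl pointwise
  where
  pointwise : (Δ ↾ P) ⊑E Θ
  pointwise y with occurs y P | dom-typing d y
  ... | true  | dom = ≤M⇒⊑M (h y) dom
  ... | false | dom with Θ y
  ...   | nothing = nothing⊑

ω-typing : ∀ {P Δ} → (∀ y → y ∈FV P → is-just (Δ y) ≡ true) → P ⦂⟨ Δ ↾ P ⊢ ω ⟩
ω-typing {P} {Δ} h = sub ωi ⊑-refl pointwise
  where
  pointwise : (Δ ↾ P) ⊑E envω P
  pointwise y with occurs y P in e
  ... | false = nothing⊑
  ... | true with Δ y | h y e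
  ...   | just _ | _ = just⊑ ⊑-ω

var-typing : ∀ {Δ x} W → Δ x ≤M just W → var x ⦂⟨ Δ ↾ var x ⊢ W ⟩
var-typing {Δ} {x} ω h = ω-typing declared
  where
  declared : ∀ y → y ∈FV var x → is-just (Δ y) ≡ true
  declared y e with ≡ᵇ-true⇒≡ y x e
  ... | refl = ≤M-is-just h refl
var-typing (W₁ ⊓ W₂) h =
  ⊓i (var-typing W₁ (≤M-trans h (≤just ⊑-⊓l))) (var-typing W₂ (≤M-trans h (≤just ⊑-⊓r)))
var-typing ⟪ T ⟫ h = restrict-weaken ax (↦-≤E h)

app-restr : ∀ {P₁ P₂ Δ U T} → P₁ ⦂⟨ Δ ↾ P₁ ⊢ ⟪ U ⇒ T ⟫ ⟩ → P₂ ⦂⟨ Δ ↾ P₂ ⊢ U ⟩ →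
  app P₁ P₂ ⦂⟨ Δ ↾ app P₁ P₂ ⊢ ⟪ T ⟫ ⟩
app-restr {P₁} {P₂} {Δ} d₁ d₂ = sub (⇒e d₁ d₂) ⊑-refl pointwise
  where
  pointwise : (Δ ↾ app P₁ P₂) ⊑E ((Δ ↾ P₁) ⊓E (Δ ↾ P₂))
  pointwise y with occurs y P₁ | occurs y P₂ | Δ y
  ... | true  | true  | just _  = just⊑ ⊑-idem
  ... | true  | true  | nothing = nothing⊑
  ... | true  | false | just _  = ⊑M-refl
  ... | true  | false | nothing = nothing⊑
  ... | false | true  | just _  = ⊑M-refl
  ... | false | true  | nothing = nothing⊑
  ... | false | false | _       = nothing⊑

-- (→i) for restricted typings; if the bound variable does not occur,
-- the abstraction is typed by (→'i) and subsumption (U ⊑ ω).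
lam-restr : ∀ {Q Δ U T} → Q ⦂⟨ (just U ▸ Δ) ↾ Q ⊢ ⟪ T ⟫ ⟩ →
  lam Q ⦂⟨ Δ ↾ lam Q ⊢ ⟪ U ⇒ T ⟫ ⟩
lam-restr {Q} {Δ} {U} d with occurs 0 Q in e
... | true  = ⇒i (sub d ⊑-refl pointwise)
  where
  pointwise : (just U ▸ (Δ ↾ lam Q)) ⊑E ((just U ▸ Δ) ↾ Q)
  pointwise zero    rewrite e = ⊑M-refl
  pointwise (suc y) = ⊑M-refl
... | false = subsume (⇒i' (sub d ⊑-refl pointwise)) (⊑-⇒ ⊑-ω ⊑-refl)
  where
  pointwise : (nothing ▸ (Δ ↾ lam Q)) ⊑E ((just U ▸ Δ) ↾ Q)
  pointwise zero    rewrite e = nothing⊑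
  pointwise (suc y) = ⊑M-refl

lam-restr' : ∀ {Q Δ T} → Q ⦂⟨ (nothing ▸ Δ) ↾ Q ⊢ ⟪ T ⟫ ⟩ →
  lam Q ⦂⟨ Δ ↾ lam Q ⊢ ⟪ ω ⇒ T ⟫ ⟩
lam-restr' {Q} {Δ} d = ⇒i' (sub d ⊑-refl pointwise)
  where
  pointwise : (nothing ▸ (Δ ↾ lam Q)) ⊑E ((nothing ▸ Δ) ↾ Q)
  pointwise zero with occurs 0 Q
  ... | true  = nothing⊑
  ... | false = nothing⊑
  pointwise (suc y) = ⊑M-refl

ext-≤E : ∀ m {Δ ρ Γ} → (Δ ∘ ρ) ≤E Γ → ((m ▸ Δ) ∘ extR ρ) ≤E (m ▸ Γ)
ext-≤E m h zero    = ≤M-refl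
ext-≤E m h (suc x) = h x

rename-typing : ∀ {M Γ V} → M ⦂⟨ Γ ⊢ V ⟩ → ∀ ρ Δ → (Δ ∘ ρ) ≤E Γ →
  rename ρ M ⦂⟨ Δ ↾ rename ρ M ⊢ V ⟩
rename-typing (ax {x} {T}) ρ Δ h = var-typing ⟪ T ⟫ (subst≡ (Δ (ρ x) ≤M_) (↦-self x ⟪ T ⟫) (h x))
rename-typing (ωi {M}) ρ Δ h = ω-typing declared
  where
  declared : ∀ y → y ∈FV rename ρ M → is-just (Δ y) ≡ true
  declared y e with FV-rename ρ M y e
  ... | x , x∈M , refl = ≤M-is-just (h x) (trans (dom-typing (ωi {M}) x) x∈M)
rename-typing (⇒i {U = U} d) ρ Δ h =
  lam-restr (rename-typing d (extR ρ) (just U ▸ Δ) (ext-≤E (just U) h))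
rename-typing (⇒i' d) ρ Δ h =
  lam-restr' (rename-typing d (extR ρ) (nothing ▸ Δ) (ext-≤E nothing h))
rename-typing (⇒e {Γ₁ = Γ₁} {Γ₂ = Γ₂} d₁ d₂) ρ Δ h =
  app-restr (rename-typing d₁ ρ Δ (≤E-trans h (⊓E-≤ˡ Γ₁ Γ₂)))
            (rename-typing d₂ ρ Δ (≤E-trans h (⊓E-≤ʳ Γ₁ Γ₂)))
rename-typing (⊓i d₁ d₂) ρ Δ h = ⊓i (rename-typing d₁ ρ Δ h) (rename-typing d₂ ρ Δ h)
rename-typing (sub d p q) ρ Δ h =
  subsume (rename-typing d ρ Δ (≤E-trans h (⊑M⇒≤M ∘ q))) p

_⊩[_]_ : Maybe UTy → Env → Term → Set
nothing ⊩[ Δ ] P = ⊤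
just U  ⊩[ Δ ] P = P ⦂⟨ Δ ↾ P ⊢ U ⟩

TypedSub : Env → Sub → Env → Set
TypedSub Γ σ Δ = ∀ x → Γ x ⊩[ Δ ] σ x

⊩-≤ : ∀ {m' m Δ P} → m' ≤M m → m' ⊩[ Δ ] P → m ⊩[ Δ ] P
⊩-≤ ≤nothing  _ = tt
⊩-≤ (≤just p) d = subsume d p

TypedSub-≤ : ∀ {Γ' Γ σ Δ} → Γ' ≤E Γ → TypedSub Γ' σ Δ → TypedSub Γ σ Δ
TypedSub-≤ q h x = ⊩-≤ (q x) (h x)

var-⊩ : ∀ {Δ x m} → Δ x ≤M m → m ⊩[ Δ ] var x
var-⊩ {m = nothing} _ = tt
var-⊩ {m = just W}  h = var-typing W h

⊩-shift : ∀ m {m' Δ P} → m ⊩[ Δ ] P → m ⊩[ m' ▸ Δ ] rename suc P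
⊩-shift nothing  _ = tt
⊩-shift (just U) {m'} {Δ} {P} d = rename-typing d suc (m' ▸ Δ) (↾-≤ Δ P)

extS-typed : ∀ m {Γ σ Δ} → TypedSub Γ σ Δ → TypedSub (m ▸ Γ) (extS σ) (m ▸ Δ)
extS-typed m     h zero    = var-⊩ ≤M-refl
extS-typed m {Γ} h (suc x) = ⊩-shift (Γ x) (h x)

subst-typing : ∀ {M Γ V} → M ⦂⟨ Γ ⊢ V ⟩ → ∀ σ Δ → TypedSub Γ σ Δ →
  subst σ M ⦂⟨ Δ ↾ subst σ M ⊢ V ⟩
subst-typing (ax {x} {T}) σ Δ h = subst≡ (_⊩[ Δ ] σ x) (↦-self x ⟪ T ⟫) (h x)
subst-typing (ωi {M}) σ Δ h = ω-typing declared
  where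
  declared : ∀ y → y ∈FV subst σ M → is-just (Δ y) ≡ true
  declared y e with FV-subst σ M y e
  -- x ∈ FV(M), so envω M declares x : ω and σ x is typed at ω
  ... | x , x∈M , y∈σx with occurs x M | h x
  ...   | true | σx-typed = ∈dom-↾ σx-typed y∈σx
subst-typing (⇒i {U = U} d) σ Δ h =
  lam-restr (subst-typing d (extS σ) (just U ▸ Δ) (extS-typed (just U) h))
subst-typing (⇒i' d) σ Δ h =
  lam-restr' (subst-typing d (extS σ) (nothing ▸ Δ) (extS-typed nothing h))
subst-typing (⇒e {Γ₁ = Γ₁} {Γ₂ = Γ₂} d₁ d₂) σ Δ h =
  app-restr (subst-typing d₁ σ Δ (TypedSub-≤ (⊓E-≤ˡ Γ₁ Γ₂) h))
            (subst-typing d₂ σ Δ (TypedSub-≤ (⊓E-≤ʳ Γ₁ Γ₂) h))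
subst-typing (⊓i d₁ d₂) σ Δ h = ⊓i (subst-typing d₁ σ Δ h) (subst-typing d₂ σ Δ h)
subst-typing (sub d p q) σ Δ h =
  subsume (subst-typing d σ Δ (TypedSub-≤ (⊑M⇒≤M ∘ q) h)) p

lam-inversion : ∀ {M Γ V U T} → lam M ⦂⟨ Γ ⊢ V ⟩ → V ⊑ ⟪ U ⇒ T ⟫ →
  ∃[ m ] (just U ≤M m × M ⦂⟨ m ▸ Γ ⊢ ⟪ T ⟫ ⟩)
lam-inversion ωi p = ⊥-elim (ω⋢ p)
lam-inversion (⇒i {U = U'} d) p with ⇒⊑⇒-inv p
... | U⊑U' , T'⊑T = just U' , ≤just U⊑U' , subsume d T'⊑T
lam-inversion (⇒i' d) p with ⇒⊑⇒-inv p
... | _ , T'⊑T = nothing , ≤nothing , subsume d T'⊑T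
lam-inversion (⊓i d₁ d₂) p = [ lam-inversion d₁ , lam-inversion d₂ ] (⊓⊑-inv p)
lam-inversion (sub d p q) p' with lam-inversion d (⊑-trans p p')
... | m , U≤m , d' = m , U≤m , sub d' ⊑-refl (▸-⊑E m q)

sub0-typed : ∀ {N Γ₁ Γ₂ U m} → N ⦂⟨ Γ₂ ⊢ U ⟩ → just U ≤M m →
  TypedSub (m ▸ Γ₁) (sub0 N) (Γ₁ ⊓E Γ₂)
sub0-typed                 d ≤nothing  zero    = tt
sub0-typed {Γ₁ = Γ₁} {Γ₂} d (≤just p) zero    = restrict-weaken (subsume d p) (⊓E-≤ʳ Γ₁ Γ₂)
sub0-typed {Γ₁ = Γ₁} {Γ₂} d _         (suc x) = var-⊩ (⊓E-≤ˡ Γ₁ Γ₂ x)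

contract : ∀ {M N Γ₁ Γ₂ U T} → lam M ⦂⟨ Γ₁ ⊢ ⟪ U ⇒ T ⟫ ⟩ → N ⦂⟨ Γ₂ ⊢ U ⟩ →
  M [0:= N ] ⦂⟨ (Γ₁ ⊓E Γ₂) ↾ (M [0:= N ]) ⊢ ⟪ T ⟫ ⟩
contract {N = N} {Γ₁} {Γ₂} d₁ d₂ with lam-inversion d₁ ⊑-refl
... | m , U≤m , d = subst-typing d (sub0 N) (Γ₁ ⊓E Γ₂) (sub0-typed d₂ U≤m)

theorem3p5 : ∀ {M N : Term} {Γ : Env} {U : UTy} →
    M ⦂⟨ Γ ⊢ U ⟩ → M ▷β N → N ⦂⟨ Γ ↾ N ⊢ U ⟩
theorem3p5 ax ()
theorem3p5 d@ωi s = ω-typing (λ y y∈N → trans (dom-typing d y) (FV-reduct s y y∈N))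
theorem3p5 (⇒i d)  (lamC s) = lam-restr (theorem3p5 d s)
theorem3p5 (⇒i' d) (lamC s) = lam-restr' (theorem3p5 d s)
theorem3p5 (⇒e d₁ d₂) β = contract d₁ d₂
theorem3p5 (⇒e {Γ₁ = Γ₁} {Γ₂} d₁ d₂) (appL {M' = M'} s) =
  app-restr (restrict-weaken (theorem3p5 d₁ s) (≤E-trans (⊓E-≤ˡ Γ₁ Γ₂) (↾-≤ Γ₁ M')))
            (restrict-weaken d₂ (⊓E-≤ʳ Γ₁ Γ₂))
theorem3p5 (⇒e {Γ₁ = Γ₁} {Γ₂} d₁ d₂) (appR {N' = N'} s) =
  app-restr (restrict-weaken d₁ (⊓E-≤ˡ Γ₁ Γ₂))
            (restrict-weaken (theorem3p5 d₂ s) (≤E-trans (⊓E-≤ʳ Γ₁ Γ₂) (↾-≤ Γ₂ N')))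
theorem3p5 (⊓i d₁ d₂) s = ⊓i (theorem3p5 d₁ s) (theorem3p5 d₂ s)
theorem3p5 {N = N} (sub d p q) s = sub (theorem3p5 d s) p (↾-⊑E N q)
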